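{- For every $n\ge1$, the total numbers of positions on the star $K_{1,n}$ are \[P_{\textsc{Col},K_{1,n}}(1,1)=2^{n+1}+3^n,\qquad P_{\textsc{Snort},K_{1,n}}(1,1)=2^{n+1}+3^n,\qquad P_{\textsc{Cis},K_{1,n}}(1,1)=2+3^n.\]
   Context: A distance game given by a pair of sets $(S,D)$ of positive integers is played on a finite graph by two players, Left (colouring vertices blue) and Right (colouring vertices red). A position is any assignment to a subset of the vertices of the colours blue or red (other vertices empty) such that no two vertices of the same colour are at graph distance in $S$ and no two vertices of different colours are at graph distance in $D$; no assumption of alternating play is made. \textsc{Col}: $S=\{1\},D=\emptyset$; \textsc{Snort}: $S=\emptyset, D=\{1\}$; \textsc{Cis}: $S=D=\{1\}$. $P_{G,B}(1,1)$ is the total number of positions of $G$ on $B$. $K_{1,n}$ is the star with one central vertex adjacent to $n$ leaves. -}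

module Defs where

open import Data.Nat using (ℕ; zero; suc; _≡ᵇ_)
open import Data.Bool using (Bool; true; false; _∧_; _∨_; not)
open import Data.Fin using (Fin; zero; suc)
open import Data.Fin.Properties using (_≟_)
open import Data.List using (List; []; _∷_; map; concatMap; length; filter; allFin; upTo)
open import Data.Bool.ListAction using (any; all)
open import Data.Vec using (Vec; []; _∷_; lookup)
open import Relation.Nullary.Decidable using (⌊_⌋; Dec; yes; no)
open import Relation.Binary.PropositionalEquality using (_≡_)

record Graph : Set where
  field
    order : ℕ
    adj   : Fin order → Fin order → Bool
    adj-sym : ∀ u v → adj u v ≡ adj v u
    adj-irr : ∀ u → adj u u ≡ false

module _ (G : Graph) where
  open Graph G

  within : ℕ → Fin order → Fin order → Bool
  within zero    u v = ⌊ u ≟ v ⌋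
  within (suc k) u v = within k u v ∨ any (λ w → within k u w ∧ adj w v) (allFin order)

  atDist : ℕ → Fin order → Fin order → Bool
  atDist zero    u v = within zero u v
  atDist (suc k) u v = within (suc k) u v ∧ not (within k u v)

record DistanceGame : Set where
  field
    S D : ℕ → Bool
    S-pos : S 0 ≡ false
    D-pos : D 0 ≡ false

data Colour : Set where
  empty blue red : Colour

sameColour : Colour → Colour → Bool
sameColour blue blue = true
sameColour red  red  = true
sameColour _    _    = false

diffColour : Colour → Colour → Bool
diffColour blue red  = true
diffColour red  blue = true
diffColour _    _    = false

allAssignments : (m : ℕ) → List (Vec Colour m)
allAssignments zero    = [] ∷ []
allAssignments (suc m) =
  concatMap (λ c → map (c ∷_) (allAssignments m)) (empty ∷ blue ∷ red ∷ [])

module _ (γ : DistanceGame) (G : Graph) where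
  open DistanceGame γ
  open Graph G

  -- distance between two vertices lies in the set X
  -- (distances in a graph on `order` vertices are < order; disconnected
  --  pairs have infinite distance, which lies in no set)
  distIn : (ℕ → Bool) → Fin order → Fin order → Bool
  distIn X u v = any (λ k → atDist G k u v ∧ X k) (upTo order)

  pairOK : Vec Colour order → Fin order → Fin order → Bool
  pairOK c u v =
    not (sameColour (lookup c u) (lookup c v) ∧ distIn S u v)
    ∧ not (diffColour (lookup c u) (lookup c v) ∧ distIn D u v)

  isPosition : Vec Colour order → Bool
  isPosition c = all (λ u → all (λ v → pairOK c u v) (allFin order)) (allFin order)

  totalPositions : ℕ
  totalPositions = length (filter (λ c → isPosition c ≡? true) (allAssignments order))
    where
      _≡?_ : (a b : Bool) → Dec (a ≡ b)
      _≡?_ = Data.Bool._≟_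

one? : ℕ → Bool
one? n = n ≡ᵇ 1

none : ℕ → Bool
none _ = false

Col : DistanceGame
Col = record { S = one? ; D = none ; S-pos = _≡_.refl ; D-pos = _≡_.refl }

Snort : DistanceGame
Snort = record { S = none ; D = one? ; S-pos = _≡_.refl ; D-pos = _≡_.refl }

Cis : DistanceGame
Cis = record { S = one? ; D = one? ; S-pos = _≡_.refl ; D-pos = _≡_.refl }

starAdj : (n : ℕ) → Fin (suc n) → Fin (suc n) → Bool
starAdj n zero    zero    = false
starAdj n zero    (suc _) = true
starAdj n (suc _) zero    = true
starAdj n (suc _) (suc _) = false

starAdj-sym : ∀ n u v → starAdj n u v ≡ starAdj n v u
starAdj-sym n zero    zero    = _≡_.refl
starAdj-sym n zero    (suc _) = _≡_.refl
starAdj-sym n (suc _) zero    = _≡_.refl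
starAdj-sym n (suc _) (suc _) = _≡_.refl

starAdj-irr : ∀ n u → starAdj n u u ≡ false
starAdj-irr n zero    = _≡_.refl
starAdj-irr n (suc _) = _≡_.refl

Star : ℕ → Graph
Star n = record { order = suc n ; adj = starAdj n
                ; adj-sym = starAdj-sym n ; adj-irr = starAdj-irr n }

{-# OPTIONS --safe #-}
-- Two distinct vertices of K_{1,n} are at distance 1 exactly when one of them is the
-- centre, and the three games constrain only pairs at distance 1. Hence a colouring is a
-- position iff every leaf gets a colour compatible with the centre's, independently of
-- the other leaves, so P = Σ_x k(x)^n with k(x) the number of colours compatible with a
-- centre coloured x: k = (3, 2, 2) for Col and Snort and k = (3, 1, 1) for Cis.
module Submission where

open import Defs
open import Data.Bool using (Bool; true; false; _∧_; _∨_; not; if_then_else_)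
open import Data.Bool.ListAction using (any; all; and; or)
open import Data.Bool.Properties using (∧-zeroʳ; ∧-identityʳ; ∨-identityʳ; ∧-idem)
  renaming (_≟_ to _≟ᵇ_)
open import Data.Fin using (Fin; zero; suc)
open import Data.Fin.Properties using (_≟_)
open import Data.List using (List; []; _∷_; _++_; map; concatMap; length; filter; allFin; applyUpTo)
open import Data.List.Properties using (map-tabulate; map-cong; length-++; filter-++; filter-≐)
open import Data.List.Relation.Unary.All using (All; []; _∷_; universal)
open import Data.List.Relation.Unary.All.Properties using (applyUpTo⁺₂)
open import Data.Nat using (ℕ; zero; suc; _+_; _*_; _^_; _≥_; _<_; s≤s; z≤n)
open import Data.Nat.ListAction using (sum)
open import Data.Nat.Properties using (+-comm; *-comm; ^-zeroˡ; ^-distribˡ-+-*)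
open import Data.Product using (_×_; _,_)
open import Data.Vec using (Vec; []; _∷_; lookup; toList)
open import Function using (_∘_)
open import Relation.Binary.PropositionalEquality
  using (_≡_; refl; sym; trans; cong; cong₂; _≗_; module ≡-Reasoning)
open import Relation.Nullary.Decidable using (⌊_⌋; yes; no)

map-allFin-suc : ∀ {A : Set} n (f : Fin (suc n) → A) →
  map f (allFin (suc n)) ≡ f zero ∷ map (f ∘ suc) (allFin n)
map-allFin-suc n f =
  cong (f zero ∷_) (trans (map-tabulate suc f) (sym (map-tabulate (λ i → i) (f ∘ suc))))

all-allFin-suc : ∀ n (p : Fin (suc n) → Bool) →
  all p (allFin (suc n)) ≡ p zero ∧ all (p ∘ suc) (allFin n)
all-allFin-suc n p = cong and (map-allFin-suc n p)

any-allFin-suc : ∀ n (p : Fin (suc n) → Bool) →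
  any p (allFin (suc n)) ≡ p zero ∨ any (p ∘ suc) (allFin n)
any-allFin-suc n p = cong or (map-allFin-suc n p)

all-cong : ∀ {A : Set} {p q : A → Bool} → p ≗ q → all p ≗ all q
all-cong p≗q xs = cong and (map-cong p≗q xs)

any-cong : ∀ {A : Set} {p q : A → Bool} → p ≗ q → any p ≗ any q
any-cong p≗q xs = cong or (map-cong p≗q xs)

all-const-true : ∀ {A : Set} (xs : List A) → all (λ _ → true) xs ≡ true
all-const-true []       = refl
all-const-true (_ ∷ xs) = all-const-true xs

any-none : ∀ {A : Set} {p : A → Bool} {xs} → All (λ x → p x ≡ false) xs → any p xs ≡ false
any-none []         = refl
any-none (px ∷ pxs) rewrite px = any-none pxs

all-allFin-lookup : ∀ {A : Set} {n} (p : A → Bool) (v : Vec A n) →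
  all (p ∘ lookup v) (allFin n) ≡ all p (toList v)
all-allFin-lookup p []       = refl
all-allFin-lookup p (x ∷ v) =
  trans (all-allFin-suc _ (p ∘ lookup (x ∷ v))) (cong (p x ∧_) (all-allFin-lookup p v))

isYes-suc≟suc : ∀ {n} (u w : Fin n) → ⌊ suc u ≟ suc w ⌋ ≡ ⌊ u ≟ w ⌋
isYes-suc≟suc u w with u ≟ w
... | yes _ = refl
... | no _  = refl

any-select : ∀ n (u : Fin n) (f : Fin n → Bool) → any (λ w → ⌊ u ≟ w ⌋ ∧ f w) (allFin n) ≡ f u
any-select (suc n) zero    f = begin
  any (λ w → ⌊ zero ≟ w ⌋ ∧ f w) (allFin (suc n))  ≡⟨ any-allFin-suc n (λ w → ⌊ zero ≟ w ⌋ ∧ f w) ⟩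
  f zero ∨ any (λ _ → false) (allFin n)            ≡⟨ cong (f zero ∨_) (any-none (universal (λ _ → refl) (allFin n))) ⟩
  f zero ∨ false                                   ≡⟨ ∨-identityʳ (f zero) ⟩
  f zero                                           ∎
  where open ≡-Reasoning
any-select (suc n) (suc u) f = begin
  any (λ w → ⌊ suc u ≟ w ⌋ ∧ f w) (allFin (suc n))  ≡⟨ any-allFin-suc n (λ w → ⌊ suc u ≟ w ⌋ ∧ f w) ⟩
  any (λ w → ⌊ suc u ≟ suc w ⌋ ∧ f (suc w)) (allFin n)
    ≡⟨ any-cong (λ w → cong (_∧ f (suc w)) (isYes-suc≟suc u w)) (allFin n) ⟩
  any (λ w → ⌊ u ≟ w ⌋ ∧ f (suc w)) (allFin n)      ≡⟨ any-select n u (f ∘ suc) ⟩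
  f (suc u)                                         ∎
  where open ≡-Reasoning

-- totalPositions γ G unfolds to countTrue (isPosition γ G) (allAssignments _).
countTrue : ∀ {A : Set} → (A → Bool) → List A → ℕ
countTrue p xs = length (filter (λ x → p x ≟ᵇ true) xs)

countTrue-++ : ∀ {A : Set} (p : A → Bool) xs ys →
  countTrue p (xs ++ ys) ≡ countTrue p xs + countTrue p ys
countTrue-++ p xs ys =
  trans (cong length (filter-++ (λ x → p x ≟ᵇ true) xs ys)) (length-++ (filter (λ x → p x ≟ᵇ true) xs))

countTrue-map : ∀ {A B : Set} (p : B → Bool) (f : A → B) xs →
  countTrue p (map f xs) ≡ countTrue (p ∘ f) xs
countTrue-map p f []       = refl
countTrue-map p f (x ∷ xs) with p (f x)
... | true  = cong suc (countTrue-map p f xs)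
... | false = countTrue-map p f xs

countTrue-concatMap : ∀ {A B : Set} (p : B → Bool) (f : A → List B) xs →
  countTrue p (concatMap f xs) ≡ sum (map (countTrue p ∘ f) xs)
countTrue-concatMap p f []       = refl
countTrue-concatMap p f (x ∷ xs) =
  trans (countTrue-++ p (f x) (concatMap f xs)) (cong (countTrue p (f x) +_) (countTrue-concatMap p f xs))

countTrue-cong : ∀ {A : Set} {p q : A → Bool} → p ≗ q → countTrue p ≗ countTrue q
countTrue-cong {p = p} {q} p≗q =
  cong length ∘ filter-≐ (λ x → p x ≟ᵇ true) (λ x → q x ≟ᵇ true)
                         ((λ {x} → trans (sym (p≗q x))) , (λ {x} → trans (p≗q x)))

countTrue-const-false : ∀ {A : Set} (xs : List A) → countTrue (λ _ → false) xs ≡ 0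
countTrue-const-false []       = refl
countTrue-const-false (_ ∷ xs) = countTrue-const-false xs

sum-countTrue-∧ : ∀ {A B : Set} (q : B → Bool) (p : A → Bool) cs xs →
  sum (map (λ c → countTrue (λ x → q c ∧ p x) xs) cs) ≡ countTrue q cs * countTrue p xs
sum-countTrue-∧ q p []       xs = refl
sum-countTrue-∧ q p (c ∷ cs) xs with q c
... | true  = cong (countTrue p xs +_) (sum-countTrue-∧ q p cs xs)
... | false = cong₂ _+_ (countTrue-const-false xs) (sum-countTrue-∧ q p cs xs)

colours : List Colour
colours = empty ∷ blue ∷ red ∷ []

countTrue-allAssignments : ∀ (q : Colour → Bool) m →
  countTrue (all q ∘ toList) (allAssignments m) ≡ countTrue q colours ^ m
countTrue-allAssignments q zero    = refl
countTrue-allAssignments q (suc m) = begin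
  countTrue (all q ∘ toList) (allAssignments (suc m))
    ≡⟨ countTrue-concatMap (all q ∘ toList) (λ c → map (c ∷_) A) colours ⟩
  sum (map (λ c → countTrue (all q ∘ toList) (map (c ∷_) A)) colours)
    ≡⟨ cong sum (map-cong (λ c → countTrue-map (all q ∘ toList) (c ∷_) A) colours) ⟩
  sum (map (λ c → countTrue (λ v → q c ∧ all q (toList v)) A) colours)
    ≡⟨ sum-countTrue-∧ q (all q ∘ toList) colours A ⟩
  countTrue q colours * countTrue (all q ∘ toList) A
    ≡⟨ cong (countTrue q colours *_) (countTrue-allAssignments q m) ⟩
  countTrue q colours ^ suc m
    ∎
  where
  open ≡-Reasoning
  A : List (Vec Colour m)
  A = allAssignments m

atDist-one : ∀ G u v → atDist G 1 u v ≡ Graph.adj G u v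
atDist-one G u v
  rewrite any-select (Graph.order G) u (λ w → Graph.adj G w v)
  with u ≟ v
... | yes refl = sym (Graph.adj-irr G u)
... | no _     = ∧-identityʳ (Graph.adj G u v)

-- Together with S-pos and D-pos this says the set is contained in {1}.
VanishesBeyondOne : (ℕ → Bool) → Set
VanishesBeyondOne X = ∀ k → X (2 + k) ≡ false

distIn-vanishingBeyondOne : ∀ γ G {X : ℕ → Bool} → 1 < Graph.order G →
  X 0 ≡ false → VanishesBeyondOne X → ∀ u v → distIn γ G X u v ≡ Graph.adj G u v ∧ X 1
-- upTo (2 + m) unfolds to 0 ∷ 1 ∷ applyUpTo (2 +_) m.
distIn-vanishingBeyondOne γ G@record { order = suc (suc m) } {X} (s≤s (s≤s z≤n)) X0 X-beyond u v
  rewrite X0 | ∧-zeroʳ (atDist G 0 u v) | atDist-one G u v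
        | any-none {p = λ k → atDist G k u v ∧ X k} {xs = applyUpTo (λ k → suc (suc k)) m}
            (applyUpTo⁺₂ _ m (λ k → trans (cong (atDist G (2 + k) u v ∧_) (X-beyond k)) (∧-zeroʳ _)))
  = ∨-identityʳ _

compatible : DistanceGame → Colour → Colour → Bool
compatible γ a b = not (sameColour a b ∧ S 1) ∧ not (diffColour a b ∧ D 1)
  where open DistanceGame γ

compatible-comm : ∀ γ a b → compatible γ a b ≡ compatible γ b a
compatible-comm γ empty empty = refl
compatible-comm γ empty blue  = refl
compatible-comm γ empty red   = refl
compatible-comm γ blue  empty = refl
compatible-comm γ blue  blue  = refl
compatible-comm γ blue  red   = refl
compatible-comm γ red   empty = refl
compatible-comm γ red   blue  = refl
compatible-comm γ red   red   = refl

module _ (γ : DistanceGame) (S-beyond : VanishesBeyondOne (DistanceGame.S γ))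
         (D-beyond : VanishesBeyondOne (DistanceGame.D γ)) where
  open DistanceGame γ

  pairOK-adjacency : ∀ G → 1 < Graph.order G → ∀ c u v →
    pairOK γ G c u v ≡ (if Graph.adj G u v then compatible γ (lookup c u) (lookup c v) else true)
  pairOK-adjacency G 1<order c u v =
    trans (cong₂ (λ s d → not (same ∧ s) ∧ not (diff ∧ d))
                 (distIn-vanishingBeyondOne γ G 1<order S-pos S-beyond u v)
                 (distIn-vanishingBeyondOne γ G 1<order D-pos D-beyond u v))
          (gated (Graph.adj G u v))
    where
    same diff : Bool
    same = sameColour (lookup c u) (lookup c v)
    diff = diffColour (lookup c u) (lookup c v)

    gated : ∀ e → not (same ∧ (e ∧ S 1)) ∧ not (diff ∧ (e ∧ D 1))
                  ≡ (if e then compatible γ (lookup c u) (lookup c v) else true)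
    gated true  = refl
    gated false rewrite ∧-zeroʳ same | ∧-zeroʳ diff = refl

  isPosition-star : ∀ m x (ls : Vec Colour (suc m)) →
    isPosition γ (Star (suc m)) (x ∷ ls) ≡ all (compatible γ x) (toList ls)
  isPosition-star m x ls = begin
    all row (allFin (suc (suc m)))                  ≡⟨ all-allFin-suc (suc m) row ⟩
    row zero ∧ all (row ∘ suc) leaves              ≡⟨ cong₂ _∧_ centreRow (all-cong leafRow leaves) ⟩
    all toCentre leaves ∧ all toCentre leaves       ≡⟨ ∧-idem _ ⟩
    all toCentre leaves                             ≡⟨ all-allFin-lookup (compatible γ x) ls ⟩
    all (compatible γ x) (toList ls)                ∎
    where
    open ≡-Reasoning
    leaves : List (Fin (suc m))
    leaves = allFin (suc m)

    ok : Fin (suc (suc m)) → Fin (suc (suc m)) → Bool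
    ok = pairOK γ (Star (suc m)) (x ∷ ls)

    ok-star : ∀ u v → ok u v ≡ (if starAdj (suc m) u v
                                 then compatible γ (lookup (x ∷ ls) u) (lookup (x ∷ ls) v) else true)
    ok-star = pairOK-adjacency (Star (suc m)) (s≤s (s≤s z≤n)) (x ∷ ls)

    row : Fin (suc (suc m)) → Bool
    row u = all (ok u) (allFin (suc (suc m)))

    toCentre : Fin (suc m) → Bool
    toCentre j = compatible γ x (lookup ls j)

    centreRow : row zero ≡ all toCentre leaves
    centreRow = trans (all-allFin-suc (suc m) (ok zero))
                      (cong₂ _∧_ (ok-star zero zero) (all-cong (ok-star zero ∘ suc) leaves))

    leafRow : ∀ i → row (suc i) ≡ toCentre i
    leafRow i = begin
      row (suc i)                                     ≡⟨ all-allFin-suc (suc m) (ok (suc i)) ⟩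
      ok (suc i) zero ∧ all (ok (suc i) ∘ suc) leaves
        ≡⟨ cong₂ _∧_ (ok-star (suc i) zero)
                     (trans (all-cong (ok-star (suc i) ∘ suc) leaves) (all-const-true leaves)) ⟩
      compatible γ (lookup ls i) x ∧ true             ≡⟨ ∧-identityʳ _ ⟩
      compatible γ (lookup ls i) x                    ≡⟨ compatible-comm γ (lookup ls i) x ⟩
      toCentre i                                      ∎

  positionsWithCentre : ∀ m x →
    countTrue (isPosition γ (Star (suc m))) (map (x ∷_) (allAssignments (suc m)))
      ≡ countTrue (compatible γ x) colours ^ suc m
  positionsWithCentre m x = begin
    countTrue (isPosition γ (Star (suc m))) (map (x ∷_) A)
      ≡⟨ countTrue-map (isPosition γ (Star (suc m))) (x ∷_) A ⟩
    countTrue (isPosition γ (Star (suc m)) ∘ (x ∷_)) A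
      ≡⟨ countTrue-cong (isPosition-star m x) A ⟩
    countTrue (all (compatible γ x) ∘ toList) A
      ≡⟨ countTrue-allAssignments (compatible γ x) (suc m) ⟩
    countTrue (compatible γ x) colours ^ suc m
      ∎
    where
    open ≡-Reasoning
    A : List (Vec Colour (suc m))
    A = allAssignments (suc m)

  totalPositions-star : ∀ m →
    totalPositions γ (Star (suc m)) ≡ sum (map (λ x → countTrue (compatible γ x) colours ^ suc m) colours)
  totalPositions-star m =
    trans (countTrue-concatMap (isPosition γ (Star (suc m))) (λ x → map (x ∷_) (allAssignments (suc m))) colours)
          (cong sum (map-cong (positionsWithCentre m) colours))

three-two-two : ∀ n → 3 ^ n + (2 ^ n + (2 ^ n + 0)) ≡ 2 ^ (n + 1) + 3 ^ n
three-two-two n = begin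
  3 ^ n + (2 ^ n + (2 ^ n + 0))  ≡⟨ +-comm (3 ^ n) _ ⟩
  2 * 2 ^ n + 3 ^ n              ≡⟨ cong (_+ 3 ^ n) (*-comm 2 (2 ^ n)) ⟩
  2 ^ n * 2 ^ 1 + 3 ^ n          ≡⟨ cong (_+ 3 ^ n) (^-distribˡ-+-* 2 n 1) ⟨
  2 ^ (n + 1) + 3 ^ n            ∎
  where open ≡-Reasoning

three-one-one : ∀ n → 3 ^ n + (1 ^ n + (1 ^ n + 0)) ≡ 2 + 3 ^ n
three-one-one n rewrite ^-zeroˡ n = +-comm (3 ^ n) 2

mainTheorem10 : (n : ℕ) → n ≥ 1 →
    (totalPositions Col (Star n) ≡ 2 ^ (n + 1) + 3 ^ n)
    × (totalPositions Snort (Star n) ≡ 2 ^ (n + 1) + 3 ^ n)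
    × (totalPositions Cis (Star n) ≡ 2 + 3 ^ n)
mainTheorem10 (suc m) _ =
    trans (totalPositions-star Col   (λ _ → refl) (λ _ → refl) m) (three-two-two (suc m))
  , trans (totalPositions-star Snort (λ _ → refl) (λ _ → refl) m) (three-two-two (suc m))
  , trans (totalPositions-star Cis   (λ _ → refl) (λ _ → refl) m) (three-one-one (suc m))
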